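{- For $i=1,2$ let $\mathbb{R}^{m_i}=B_i^{\mathbb{R}}\oplus Z_i^{\mathbb{R}}$ be rational orthogonal decompositions with critical groups $K_i=\mathbb{Z}^{m_i}/(B_i\oplus Z_i)$, and let $f:\mathbb{R}^{m_1}\to\mathbb{R}^{m_2}$ be a morphism of rational orthogonal decompositions, inducing homomorphisms $f:K_1\to K_2$ and $f^t:K_2\to K_1$. Let $\theta_i:K_i\to K_i^*=\operatorname{Hom}_{\mathbb{Z}}(K_i,\mathbb{Q}/\mathbb{Z})$ be the isomorphisms $x\mapsto\langle x,\cdot\rangle$ given by the pairing on $K_i$. Then $\theta_1\circ f^t=f^*\circ\theta_2$ as maps $K_2\to K_1^*$, where $f^*:K_2^*\to K_1^*$ is $f^*(\phi)=\phi\circ f$.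
   Context: $\mathbb{R}^m$ has the standard inner product. A rational orthogonal decomposition is an orthogonal decomposition $\mathbb{R}^m=B^{\mathbb{R}}\oplus Z^{\mathbb{R}}$ into subspaces spanned by integer vectors; $B=B^{\mathbb{R}}\cap\mathbb{Z}^m$, $Z=Z^{\mathbb{R}}\cap\mathbb{Z}^m$, and its critical group is $K=\mathbb{Z}^m/(B\oplus Z)$. The pairing on $K$ is $\langle x,y\rangle=\langle\pi(x),\pi(y)\rangle \bmod \mathbb{Z}\in\mathbb{Q}/\mathbb{Z}$, where $\pi$ is orthogonal projection onto $B^{\mathbb{R}}$ (or, giving the same pairing, onto $Z^{\mathbb{R}}$); it is nondegenerate, so $x\mapsto\langle x,\cdot\rangle$ is an isomorphism $K\to K^*$. A morphism of rational orthogonal decompositions is a linear map $f$ with $f(\mathbb{Z}^{m_1})\subset\mathbb{Z}^{m_2}$, $f(B_1)\subset B_2$, $f(Z_1)\subset Z_2$; then its adjoint $f^t$ satisfies $f^t(\mathbb{Z}^{m_2})\subset\mathbb{Z}^{m_1}$, $f^t(B_2)\subset B_1$, $f^t(Z_2)\subset Z_1$, so both induce maps of critical groups. -}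

module Defs where

open import Data.Nat using (ℕ; zero; suc)
open import Data.Fin using (Fin; zero; suc)
open import Data.Integer using (ℤ)
import Data.Integer as ℤ
open import Data.Rational using (ℚ; 0ℚ; _+_; _*_; _-_; _/_)
open import Data.Product using (Σ; ∃; _×_; _,_)
open import Relation.Binary.PropositionalEquality using (_≡_)

Vecℤ : ℕ → Set
Vecℤ m = Fin m → ℤ

Vecℚ : ℕ → Set
Vecℚ m = Fin m → ℚ

ι : ℤ → ℚ
ι k = k / 1

toℚ : ∀ {m} → Vecℤ m → Vecℚ m
toℚ v i = ι (v i)

∑ : ∀ {n} → (Fin n → ℚ) → ℚ
∑ {zero}  f = 0ℚ
∑ {suc n} f = f zero + ∑ (λ i → f (suc i))

_·_ : ∀ {m} → Vecℚ m → Vecℚ m → ℚ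
u · v = ∑ (λ i → u i * v i)

InSpan : ∀ {m r} → (Fin r → Vecℤ m) → Vecℚ m → Set
InSpan {m} {r} gens v =
  Σ (Fin r → ℚ) λ c → ∀ i → v i ≡ ∑ (λ j → c j * ι (gens j i))

-- Since these subspaces
-- are spanned by integer vectors, all data are rational; we work with the
-- rational points B^ℝ ∩ ℚ^m and Z^ℝ ∩ ℚ^m.
record ROD (m : ℕ) : Set where
  field
    r s  : ℕ
    bgen : Fin r → Vecℤ m
    zgen : Fin s → Vecℤ m
    orth  : ∀ u w → InSpan bgen u → InSpan zgen w → u · w ≡ 0ℚ
    spans : ∀ (v : Vecℚ m) → Σ (Vecℚ m) λ u → Σ (Vecℚ m) λ w →
              InSpan bgen u × InSpan zgen w × (∀ i → v i ≡ u i + w i)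

  InBℝ : Vecℚ m → Set
  InBℝ = InSpan bgen

  InZℝ : Vecℚ m → Set
  InZℝ = InSpan zgen

  InB : Vecℤ m → Set
  InB v = InBℝ (toℚ v)

  InZ : Vecℤ m → Set
  InZ v = InZℝ (toℚ v)

  -- u = π(x), the orthogonal projection of x onto B^ℝ
  -- (u ∈ B^ℝ and x − u ∈ Z^ℝ = (B^ℝ)^⊥).
  IsProj : Vecℚ m → Vecℚ m → Set
  IsProj x u = InBℝ u × InZℝ (λ i → x i - u i)

open ROD public

-- Integer matrices Fin m₂ × Fin m₁ represent linear maps ℝ^{m₁} → ℝ^{m₂}
-- sending ℤ^{m₁} into ℤ^{m₂}.
Mat : ℕ → ℕ → Set
Mat m₂ m₁ = Fin m₂ → Fin m₁ → ℤ

∑ℤ : ∀ {n} → (Fin n → ℤ) → ℤ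
∑ℤ {zero}  f = ℤ.+ 0
∑ℤ {suc n} f = f zero ℤ.+ ∑ℤ (λ i → f (suc i))

apply : ∀ {m₂ m₁} → Mat m₂ m₁ → Vecℤ m₁ → Vecℤ m₂
apply M v i = ∑ℤ (λ j → M i j ℤ.* v j)

applyᵗ : ∀ {m₂ m₁} → Mat m₂ m₁ → Vecℤ m₂ → Vecℤ m₁
applyᵗ M v j = ∑ℤ (λ i → M i j ℤ.* v i)

record IsMorphism {m₁ m₂} (D₁ : ROD m₁) (D₂ : ROD m₂) (f : Mat m₂ m₁) : Set where
  field
    mapB : ∀ v → InB D₁ v → InB D₂ (apply f v)
    mapZ : ∀ v → InZ D₁ v → InZ D₂ (apply f v)

IsInt : ℚ → Set
IsInt q = ∃ λ (k : ℤ) → q ≡ ι k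

-- θ₁ ∘ f^t = f^* ∘ θ₂ as maps K₂ → K₁^* = Hom(K₁, ℚ/ℤ):
-- for every x ∈ K₂ and every y ∈ K₁,
--   θ₁(f^t x)(y) = ⟨f^t x, y⟩₁  equals  (f^* θ₂(x))(y) = ⟨x, f y⟩₂  in ℚ/ℤ.
EqInQmodZ : ℚ → ℚ → Set
EqInQmodZ a b = IsInt (a - b)

-- Because f maps B₁ into B₂ and Z₁ into Z₂, it commutes with the orthogonal
-- projections: π₂ (f y) = f (π₁ y).  Since x · w = π x · w for w ∈ B, the
-- adjunction f^t x · v = x · f v then gives the identity already in ℚ:
--   π₁ (f^t x) · π₁ y = f^t x · π₁ y = x · f (π₁ y) = π₂ x · f (π₁ y) = π₂ x · π₂ (f y).

module Submission where

open import Defs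
open import Data.Nat using (ℕ; zero; suc)
open import Data.Fin using (Fin; zero; suc)
open import Data.Integer using (ℤ)
import Data.Integer as ℤ
import Data.Integer.Properties as ℤ
open import Data.Rational using (ℚ; 0ℚ; 1ℚ; _+_; _*_; _-_; -_; toℚᵘ)
open import Data.Rational.Properties
  using (+-assoc; +-identityˡ; +-identityʳ; +-inverseʳ; *-assoc; *-comm; *-identityˡ; *-zeroˡ;
         *-distribˡ-+; *-distribʳ-+; +-0-abelianGroup; +-*-commutativeRing;
         toℚᵘ-injective; toℚᵘ-fromℚᵘ; toℚᵘ-homo-+; toℚᵘ-homo-*)
open import Data.Rational.Unnormalised as ℚᵘ using (mkℚᵘ; *≡*) renaming (_≃_ to _≃ᵘ_)
import Data.Rational.Unnormalised.Properties as ℚᵘ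
open import Data.Product using (_,_; proj₁; proj₂)
open import Function using (_∘_; flip)
open import Algebra.Bundles using (CommutativeRing)
open import Algebra.Properties.AbelianGroup +-0-abelianGroup using (xyx⁻¹≈y)
open import Algebra.Properties.CommutativeSemigroup (CommutativeRing.*-commutativeSemigroup +-*-commutativeRing)
  using (x∙yz≈y∙xz; xy∙z≈y∙xz)
import Algebra.Properties.Semiring.Sum (CommutativeRing.semiring +-*-commutativeRing) as ℚ-Sum
open import Relation.Binary.PropositionalEquality

private
  variable
    m n p q : ℕ

toℚᵘ-ι : ∀ k → toℚᵘ (ι k) ≃ᵘ mkℚᵘ k 0
toℚᵘ-ι k = toℚᵘ-fromℚᵘ (mkℚᵘ k 0)

ι-homo-+ : ∀ a b → ι (a ℤ.+ b) ≡ ι a + ι b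
ι-homo-+ a b = toℚᵘ-injective (begin
  toℚᵘ (ι (a ℤ.+ b))              ≈⟨ toℚᵘ-ι (a ℤ.+ b) ⟩
  mkℚᵘ (a ℤ.+ b) 0                ≈⟨ *≡* (cong (ℤ._* ℤ.+ 1) (sym (cong₂ ℤ._+_ (ℤ.*-identityʳ a) (ℤ.*-identityʳ b)))) ⟩
  mkℚᵘ a 0 ℚᵘ.+ mkℚᵘ b 0          ≈⟨ ℚᵘ.+-cong (toℚᵘ-ι a) (toℚᵘ-ι b) ⟨
  toℚᵘ (ι a) ℚᵘ.+ toℚᵘ (ι b)      ≈⟨ toℚᵘ-homo-+ (ι a) (ι b) ⟨
  toℚᵘ (ι a + ι b)                ∎)
  where open ℚᵘ.≃-Reasoning

ι-homo-* : ∀ a b → ι (a ℤ.* b) ≡ ι a * ι b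
ι-homo-* a b = toℚᵘ-injective (begin
  toℚᵘ (ι (a ℤ.* b))              ≈⟨ toℚᵘ-ι (a ℤ.* b) ⟩
  mkℚᵘ a 0 ℚᵘ.* mkℚᵘ b 0          ≈⟨ ℚᵘ.*-cong (toℚᵘ-ι a) (toℚᵘ-ι b) ⟨
  toℚᵘ (ι a) ℚᵘ.* toℚᵘ (ι b)      ≈⟨ toℚᵘ-homo-* (ι a) (ι b) ⟨
  toℚᵘ (ι a * ι b)                ∎)
  where open ℚᵘ.≃-Reasoning

ι-homo-∑ : (f : Fin n → ℤ) → ι (∑ℤ f) ≡ ∑ (ι ∘ f)
ι-homo-∑ {zero}  f = refl
ι-homo-∑ {suc n} f = trans (ι-homo-+ (f zero) _) (cong (ι (f zero) +_) (ι-homo-∑ (f ∘ suc)))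

open ≡-Reasoning

∑≡sum : (f : Fin n → ℚ) → ∑ f ≡ ℚ-Sum.sum f
∑≡sum {zero}  f = refl
∑≡sum {suc n} f = cong (f zero +_) (∑≡sum (f ∘ suc))

∑-cong : {f g : Fin n → ℚ} → (∀ i → f i ≡ g i) → ∑ f ≡ ∑ g
∑-cong {zero}  f≗g = refl
∑-cong {suc n} f≗g = cong₂ _+_ (f≗g zero) (∑-cong (f≗g ∘ suc))

∑-distrib-+ : (f g : Fin n → ℚ) → ∑ (λ i → f i + g i) ≡ ∑ f + ∑ g
∑-distrib-+ f g = begin
  ∑ (λ i → f i + g i)                       ≡⟨ ∑≡sum (λ i → f i + g i) ⟩
  ℚ-Sum.sum (λ i → f i + g i)               ≡⟨ ℚ-Sum.∑-distrib-+ f g ⟩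
  ℚ-Sum.sum f + ℚ-Sum.sum g                 ≡⟨ cong₂ _+_ (∑≡sum f) (∑≡sum g) ⟨
  ∑ f + ∑ g                                 ∎

∑-comm : (f : Fin m → Fin n → ℚ) → ∑ (λ i → ∑ (f i)) ≡ ∑ (λ j → ∑ (λ i → f i j))
∑-comm f = begin
  ∑ (λ i → ∑ (f i))                         ≡⟨ ∑-cong (λ i → ∑≡sum (f i)) ⟩
  ∑ (λ i → ℚ-Sum.sum (f i))                 ≡⟨ ∑≡sum (λ i → ℚ-Sum.sum (f i)) ⟩
  ℚ-Sum.sum (λ i → ℚ-Sum.sum (f i))         ≡⟨ ℚ-Sum.∑-comm f ⟩
  ℚ-Sum.sum (λ j → ℚ-Sum.sum (λ i → f i j)) ≡⟨ ∑≡sum (λ j → ℚ-Sum.sum (λ i → f i j)) ⟨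
  ∑ (λ j → ℚ-Sum.sum (λ i → f i j))         ≡⟨ ∑-cong (λ j → ∑≡sum (λ i → f i j)) ⟨
  ∑ (λ j → ∑ (λ i → f i j))                 ∎

*-distribˡ-∑ : ∀ c (f : Fin n → ℚ) → c * ∑ f ≡ ∑ (λ i → c * f i)
*-distribˡ-∑ c f = begin
  c * ∑ f                                   ≡⟨ cong (c *_) (∑≡sum f) ⟩
  c * ℚ-Sum.sum f                           ≡⟨ ℚ-Sum.*-distribˡ-sum c f ⟩
  ℚ-Sum.sum (λ i → c * f i)                 ≡⟨ ∑≡sum (λ i → c * f i) ⟨
  ∑ (λ i → c * f i)                         ∎

*-distribʳ-∑ : ∀ c (f : Fin n → ℚ) → ∑ f * c ≡ ∑ (λ i → f i * c)
*-distribʳ-∑ c f = begin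
  ∑ f * c                                   ≡⟨ cong (_* c) (∑≡sum f) ⟩
  ℚ-Sum.sum f * c                           ≡⟨ ℚ-Sum.*-distribʳ-sum c f ⟩
  ℚ-Sum.sum (λ i → f i * c)                 ≡⟨ ∑≡sum (λ i → f i * c) ⟨
  ∑ (λ i → f i * c)                         ∎

∑-*-∑ : ∀ (a : Fin m → ℚ) (b : Fin m → Fin n → ℚ) →
        ∑ (λ i → a i * ∑ (b i)) ≡ ∑ (λ j → ∑ (λ i → a i * b i j))
∑-*-∑ a b = trans (∑-cong (λ i → *-distribˡ-∑ (a i) (b i))) (∑-comm (λ i j → a i * b i j))

δ : Fin n → Fin n → ℚ
δ zero    zero    = 1ℚ
δ zero    (suc j) = 0ℚ
δ (suc i) zero    = 0ℚ
δ (suc i) (suc j) = δ i j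

∑-δ : ∀ i (f : Fin n → ℚ) → ∑ (λ j → δ i j * f j) ≡ f i
∑-δ {suc n} zero f = begin
  1ℚ * f zero + ∑ (λ j → 0ℚ * f (suc j))    ≡⟨ cong₂ _+_ (*-identityˡ (f zero)) (∑-cong (λ j → *-zeroˡ (f (suc j)))) ⟩
  f zero + ∑ (λ (_ : Fin n) → 0ℚ)           ≡⟨ cong (f zero +_) (trans (∑≡sum (λ (_ : Fin n) → 0ℚ)) (ℚ-Sum.sum-replicate-zero n)) ⟩
  f zero + 0ℚ                               ≡⟨ +-identityʳ (f zero) ⟩
  f zero                                    ∎
∑-δ (suc i) f = trans (cong₂ _+_ (*-zeroˡ (f zero)) (∑-δ i (f ∘ suc))) (+-identityˡ (f (suc i)))

p+[q-p]≡q : ∀ p q → p + (q - p) ≡ q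
p+[q-p]≡q p q = trans (sym (+-assoc p q (- p))) (xyx⁻¹≈y p q)

·-comm : (u v : Vecℚ n) → u · v ≡ v · u
·-comm u v = ∑-cong (λ i → *-comm (u i) (v i))

·-distribʳ-+ : (u v w : Vecℚ n) → (λ i → u i + v i) · w ≡ u · w + v · w
·-distribʳ-+ u v w = trans (∑-cong (λ i → *-distribʳ-+ (w i) (u i) (v i)))
                           (∑-distrib-+ (λ i → u i * w i) (λ i → v i * w i))

lincomb : (Fin p → ℚ) → (Fin p → Vecℚ n) → Vecℚ n
lincomb c g i = ∑ (λ k → c k * g k i)

lincomb-lincomb : ∀ (c : Fin p → ℚ) (d : Fin p → Fin q → ℚ) (h : Fin q → Vecℚ n) i →
                  lincomb c (λ k → lincomb (d k) h) i ≡ lincomb (λ l → ∑ (λ k → c k * d k l)) h i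
lincomb-lincomb c d h i = begin
  ∑ (λ k → c k * ∑ (λ l → d k l * h l i))      ≡⟨ ∑-*-∑ c (λ k l → d k l * h l i) ⟩
  ∑ (λ l → ∑ (λ k → c k * (d k l * h l i)))    ≡⟨ ∑-cong (λ l → ∑-cong (λ k → *-assoc (c k) (d k l) (h l i))) ⟨
  ∑ (λ l → ∑ (λ k → c k * d k l * h l i))      ≡⟨ ∑-cong (λ l → *-distribʳ-∑ (h l i) (λ k → c k * d k l)) ⟨
  ∑ (λ l → ∑ (λ k → c k * d k l) * h l i)      ∎

InSpan-resp-≗ : (gens : Fin p → Vecℤ n) {v w : Vecℚ n} →
                (∀ i → v i ≡ w i) → InSpan gens v → InSpan gens w
InSpan-resp-≗ gens v≗w (c , v≗comb) = c , λ i → trans (sym (v≗w i)) (v≗comb i)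

gen-InSpan : (gens : Fin p → Vecℤ n) (k : Fin p) → InSpan gens (toℚ (gens k))
gen-InSpan gens k = δ k , λ i → sym (∑-δ k (λ l → ι (gens l i)))

Matℚ : ℕ → ℕ → Set
Matℚ m n = Fin m → Fin n → ℚ

toℚᴹ : Mat m n → Matℚ m n
toℚᴹ M i j = ι (M i j)

_⊙_ : Matℚ m n → Vecℚ n → Vecℚ m
(A ⊙ v) i = ∑ (λ j → A i j * v j)

toℚ-apply : (M : Mat m n) (v : Vecℤ n) → ∀ i → toℚ (apply M v) i ≡ (toℚᴹ M ⊙ toℚ v) i
toℚ-apply M v i = trans (ι-homo-∑ (λ j → M i j ℤ.* v j)) (∑-cong (λ j → ι-homo-* (M i j) (v j)))

⊙-cong : (A : Matℚ m n) {v w : Vecℚ n} → (∀ j → v j ≡ w j) → ∀ i → (A ⊙ v) i ≡ (A ⊙ w) i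
⊙-cong A v≗w i = ∑-cong (λ j → cong (A i j *_) (v≗w j))

⊙-distrib-+ : (A : Matℚ m n) (v w : Vecℚ n) → ∀ i → (A ⊙ (λ j → v j + w j)) i ≡ (A ⊙ v) i + (A ⊙ w) i
⊙-distrib-+ A v w i = trans (∑-cong (λ j → *-distribˡ-+ (A i j) (v j) (w j)))
                            (∑-distrib-+ (λ j → A i j * v j) (λ j → A i j * w j))

⊙-distrib-- : (A : Matℚ m n) (v w : Vecℚ n) → ∀ i → (A ⊙ (λ j → v j - w j)) i ≡ (A ⊙ v) i - (A ⊙ w) i
⊙-distrib-- A v w i = begin
  (A ⊙ (λ j → v j - w j)) i                           ≡⟨ xyx⁻¹≈y ((A ⊙ w) i) _ ⟨
  (A ⊙ w) i + (A ⊙ (λ j → v j - w j)) i - (A ⊙ w) i   ≡⟨ cong (_- (A ⊙ w) i) (⊙-distrib-+ A w (λ j → v j - w j) i) ⟨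
  (A ⊙ (λ j → w j + (v j - w j))) i - (A ⊙ w) i       ≡⟨ cong (_- (A ⊙ w) i) (⊙-cong A (λ j → p+[q-p]≡q (w j) (v j)) i) ⟩
  (A ⊙ v) i - (A ⊙ w) i                               ∎

⊙-lincomb : (A : Matℚ m n) (c : Fin p → ℚ) (g : Fin p → Vecℚ n) →
            ∀ i → (A ⊙ lincomb c g) i ≡ lincomb c (λ k → A ⊙ g k) i
⊙-lincomb A c g i = begin
  ∑ (λ j → A i j * ∑ (λ k → c k * g k j))      ≡⟨ ∑-*-∑ (A i) (λ j k → c k * g k j) ⟩
  ∑ (λ k → ∑ (λ j → A i j * (c k * g k j)))    ≡⟨ ∑-cong (λ k → ∑-cong (λ j → x∙yz≈y∙xz (A i j) (c k) (g k j))) ⟩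
  ∑ (λ k → ∑ (λ j → c k * (A i j * g k j)))    ≡⟨ ∑-cong (λ k → *-distribˡ-∑ (c k) (λ j → A i j * g k j)) ⟨
  ∑ (λ k → c k * ∑ (λ j → A i j * g k j))      ∎

⊙-adjoint : (A : Matℚ m n) (x : Vecℚ m) (v : Vecℚ n) → (flip A ⊙ x) · v ≡ x · (A ⊙ v)
⊙-adjoint A x v = begin
  ∑ (λ j → ∑ (λ i → A i j * x i) * v j)        ≡⟨ ∑-cong (λ j → *-distribʳ-∑ (v j) (λ i → A i j * x i)) ⟩
  ∑ (λ j → ∑ (λ i → A i j * x i * v j))        ≡⟨ ∑-comm (λ j i → A i j * x i * v j) ⟩
  ∑ (λ i → ∑ (λ j → A i j * x i * v j))        ≡⟨ ∑-cong (λ i → ∑-cong (λ j → xy∙z≈y∙xz (A i j) (x i) (v j))) ⟩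
  ∑ (λ i → ∑ (λ j → x i * (A i j * v j)))      ≡⟨ ∑-cong (λ i → *-distribˡ-∑ (x i) (λ j → A i j * v j)) ⟨
  ∑ (λ i → x i * ∑ (λ j → A i j * v j))        ∎

⊙-InSpan : (A : Matℚ m n) {g₁ : Fin p → Vecℤ n} {g₂ : Fin q → Vecℤ m} →
           (∀ k → InSpan g₂ (A ⊙ toℚ (g₁ k))) → ∀ {v} → InSpan g₁ v → InSpan g₂ (A ⊙ v)
⊙-InSpan {p = p} {q = q} A {g₁} {g₂} images {v} (c , v≗comb) = (λ l → ∑ (λ k → c k * d k l)) , λ i → begin
  (A ⊙ v) i                                       ≡⟨ ⊙-cong A v≗comb i ⟩
  (A ⊙ lincomb c (toℚ ∘ g₁)) i                    ≡⟨ ⊙-lincomb A c (toℚ ∘ g₁) i ⟩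
  lincomb c (λ k → A ⊙ toℚ (g₁ k)) i              ≡⟨ ∑-cong (λ k → cong (c k *_) (proj₂ (images k) i)) ⟩
  lincomb c (λ k → lincomb (d k) (toℚ ∘ g₂)) i    ≡⟨ lincomb-lincomb c d (toℚ ∘ g₂) i ⟩
  lincomb (λ l → ∑ (λ k → c k * d k l)) (toℚ ∘ g₂) i ∎
  where
  d : Fin p → Fin q → ℚ
  d k = proj₁ (images k)

⊙-preserves-InSpan : (M : Mat m n) {g₁ : Fin p → Vecℤ n} {g₂ : Fin q → Vecℤ m} →
                     (∀ v → InSpan g₁ (toℚ v) → InSpan g₂ (toℚ (apply M v))) →
                     ∀ {v} → InSpan g₁ v → InSpan g₂ (toℚᴹ M ⊙ v)
⊙-preserves-InSpan M {g₁} {g₂} preserves = ⊙-InSpan (toℚᴹ M) {g₁} {g₂} λ k →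
  InSpan-resp-≗ g₂ (toℚ-apply M (g₁ k)) (preserves (g₁ k) (gen-InSpan g₁ k))

applyᵗ-adjoint : (M : Mat m n) (x : Vecℤ m) (v : Vecℚ n) → toℚ (applyᵗ M x) · v ≡ toℚ x · (toℚᴹ M ⊙ v)
applyᵗ-adjoint M x v = trans (∑-cong (λ j → cong (_* v j) (toℚ-apply (flip M) x j)))
                             (⊙-adjoint (toℚᴹ M) (toℚ x) v)

module _ (D : ROD n) where

  ·-cong-Zℝ : {a b z w : Vecℚ n} → InZℝ D z → InBℝ D w → (∀ i → a i ≡ b i + z i) → a · w ≡ b · w
  ·-cong-Zℝ {a} {b} {z} {w} z∈Z w∈B a≗b+z = begin
    a · w                    ≡⟨ ∑-cong (λ i → cong (_* w i) (a≗b+z i)) ⟩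
    (λ i → b i + z i) · w    ≡⟨ ·-distribʳ-+ b z w ⟩
    b · w + z · w            ≡⟨ cong (b · w +_) (trans (·-comm z w) (orth D w z w∈B z∈Z)) ⟩
    b · w + 0ℚ               ≡⟨ +-identityʳ (b · w) ⟩
    b · w                    ∎

  ·-IsProj : (x : Vecℚ n) {u w : Vecℚ n} → IsProj D x u → InBℝ D w → x · w ≡ u · w
  ·-IsProj x {u} (_ , x-u∈Z) w∈B = ·-cong-Zℝ {x} {u} x-u∈Z w∈B (λ i → sym (p+[q-p]≡q (u i) (x i)))

module _ {D₁ : ROD m} {D₂ : ROD n} {f : Mat n m} (mor : IsMorphism D₁ D₂ f) where
  open IsMorphism mor

  apply-IsProj : ∀ {y v} → IsProj D₁ (toℚ y) v → IsProj D₂ (toℚ (apply f y)) (toℚᴹ f ⊙ v)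
  apply-IsProj {y} {v} (v∈B , y-v∈Z) =
    ⊙-preserves-InSpan f {bgen D₁} {bgen D₂} mapB v∈B ,
    InSpan-resp-≗ (zgen D₂) fy-fv (⊙-preserves-InSpan f {zgen D₁} {zgen D₂} mapZ y-v∈Z)
    where
    fy-fv : ∀ i → (toℚᴹ f ⊙ (λ j → toℚ y j - v j)) i ≡ toℚ (apply f y) i - (toℚᴹ f ⊙ v) i
    fy-fv i = trans (⊙-distrib-- (toℚᴹ f) (toℚ y) v i) (cong (_- (toℚᴹ f ⊙ v) i) (sym (toℚ-apply f y i)))

≡⇒EqInQmodZ : {a b : ℚ} → a ≡ b → EqInQmodZ a b
≡⇒EqInQmodZ {a} refl = ℤ.+ 0 , +-inverseʳ a

proposition2p5 : ∀ {m₁ m₂ : ℕ} (D₁ : ROD m₁) (D₂ : ROD m₂) (f : Mat m₂ m₁) →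
    IsMorphism D₁ D₂ f →
    ∀ (x : Vecℤ m₂) (y : Vecℤ m₁) →
    ∀ u₁ v₁ u₂ v₂ →
    IsProj D₁ (toℚ (applyᵗ f x)) u₁ → IsProj D₁ (toℚ y) v₁ →
    IsProj D₂ (toℚ x) u₂ → IsProj D₂ (toℚ (apply f y)) v₂ →
    EqInQmodZ (u₁ · v₁) (u₂ · v₂)
proposition2p5 D₁ D₂ f mor x y u₁ v₁ u₂ v₂ πfᵗx πy πx πfy = ≡⇒EqInQmodZ (begin
  u₁ · v₁                      ≡⟨ ·-IsProj D₁ (toℚ (applyᵗ f x)) πfᵗx (proj₁ πy) ⟨
  toℚ (applyᵗ f x) · v₁        ≡⟨ applyᵗ-adjoint f x v₁ ⟩
  toℚ x · (toℚᴹ f ⊙ v₁)        ≡⟨ ·-IsProj D₂ (toℚ x) πx (proj₁ fπy) ⟩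
  u₂ · (toℚᴹ f ⊙ v₁)           ≡⟨ ·-comm u₂ (toℚᴹ f ⊙ v₁) ⟩
  (toℚᴹ f ⊙ v₁) · u₂           ≡⟨ ·-IsProj D₂ (toℚ (apply f y)) fπy (proj₁ πx) ⟨
  toℚ (apply f y) · u₂         ≡⟨ ·-IsProj D₂ (toℚ (apply f y)) πfy (proj₁ πx) ⟩
  v₂ · u₂                      ≡⟨ ·-comm v₂ u₂ ⟩
  u₂ · v₂                      ∎)
  where
  fπy : IsProj D₂ (toℚ (apply f y)) (toℚᴹ f ⊙ v₁)
  fπy = apply-IsProj mor πy
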